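{- For every natural number $k$, \[ \lim_{n\to\infty}\frac{\gamma_{2t}(K_n\Box K_{n+k})}{n}=\frac32. \]
   Context: $K_n$ denotes the complete graph on $n$ vertices. The Cartesian product $G\Box H$ has vertex set $V(G)\times V(H)$, with $(u_1,v_1)\sim(u_2,v_2)$ iff either $u_1=u_2$ and $v_1\sim v_2$, or $v_1=v_2$ and $u_1\sim u_2$. A set $S$ of vertices of a graph $G$ is total $2$-dominating if every vertex of $G$ is adjacent to at least two vertices of $S$; $\gamma_{2t}(G)$ is the minimum cardinality of such a set. -}

module Defs where

open import Data.Nat using (ℕ; _≤_)
open import Data.Fin using (Fin)
open import Data.Product using (_×_; ∃-syntax; proj₁; proj₂)
open import Data.Sum using (_⊎_)
open import Data.List using (List; length)
open import Data.List.Membership.Propositional using (_∈_)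
open import Data.List.Relation.Unary.Unique.Propositional using (Unique)
open import Relation.Binary.PropositionalEquality using (_≡_; _≢_)

Vertex : ℕ → ℕ → Set
Vertex n m = Fin n × Fin m

Adj : ∀ {n m} → Vertex n m → Vertex n m → Set
Adj u v = (proj₁ u ≡ proj₁ v × proj₂ u ≢ proj₂ v)
        ⊎ (proj₂ u ≡ proj₂ v × proj₁ u ≢ proj₁ v)

-- A vertex set is represented by a duplicate-free list of vertices;
-- its cardinality is the length of the list.
Total2Dominating : ∀ {n m} → List (Vertex n m) → Set
Total2Dominating {n} {m} S =
  (v : Vertex n m) → ∃[ a ] ∃[ b ] (a ∈ S × b ∈ S × a ≢ b × Adj a v × Adj b v)

IsGamma2t : ℕ → ℕ → ℕ → Set
IsGamma2t n m g =
  (∃[ S ] (Unique S × Total2Dominating {n} {m} S × length S ≡ g))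
  × ((S : List (Vertex n m)) → Unique S → Total2Dominating S → g ≤ length S)

-- Encode a set S of vertices of K_n □ K_m as a 0/1 grid: S is total 2-dominating iff every
-- cell sees at least two marked cells in its row and column, itself excluded.
--
-- Lower bound (n ≤ m). If some row is empty, every column carries two marks, so |S| ≥ 2m; the
-- same holds with rows and columns exchanged. Otherwise let a marked cell whose row and column
-- carry d and d′ marks receive w(d) + w(d′), where w(1) = 3, w(2) = 2 and w(d) = 1 for d ≥ 3.
-- Since d + d′ ≥ 4, every marked cell receives at most 4, while every line with d ≥ 1 marks
-- hands out w(d)·d ≥ 3; hence 3(n + m) ≤ 4|S| and 3n ≤ 2|S|.
--
-- With Q = ⌊n/4⌋, mark in each column Q + d the cell of row d mod Q, and in each
-- row Q + d the cell of column d mod Q. A cell in row x < Q sees the three marks of its row in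
-- the columns Q + x, 2Q + x and 3Q + x, symmetrically for a cell in one of the first Q columns,
-- and any other cell sees one mark in its row and one in its column. This set has
-- (m − Q) + (n − Q) elements, so for m = n + k we get 2γ ≤ 3n + 2k + 3.
--
-- Both bounds together give γ/n → 3/2; γ itself exists since grids can be searched exhaustively.
module Submission where

open import Data.Bool using (Bool; true; false; _∨_)
open import Data.Empty using (⊥-elim)
open import Data.Fin using (Fin; zero; suc; toℕ; fromℕ<; _↑ˡ_; _↑ʳ_; splitAt)
open import Data.Fin.Patterns using (0F; 1F; 2F)
import Data.Fin.Properties as Finₚ
open import Data.Fin.Subset.Properties using (anySubset?)
open import Data.Integer as ℤ using (+_; +0; +[1+_]; -[1+_])
import Data.Integer.Properties as ℤₚ
open import Data.List using (List; []; _∷_; length; map; _++_; allFin)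
open import Data.List.Membership.Propositional using (_∈_; _∉_)
open import Data.List.Membership.Propositional.Properties using (∈-map⁺; ∈-map⁻; ∈-++⁺ˡ; ∈-++⁺ʳ; ∈-allFin)
open import Data.List.Properties using (length-map; length-++; length-tabulate)
open import Data.List.Relation.Binary.Disjoint.Propositional using (Disjoint)
import Data.List.Relation.Unary.All.Properties as All
open import Data.List.Relation.Unary.AllPairs using ([]; _∷_)
open import Data.List.Relation.Unary.Any using (here; there)
open import Data.List.Relation.Unary.Unique.Propositional using (Unique)
import Data.List.Relation.Unary.Unique.Propositional.Properties as Uniqueₚ
open import Data.Nat as ℕ using (ℕ; zero; suc; _+_; _*_; _≤_; z≤n; s≤s; s≤s⁻¹; NonZero; >-nonZero)
open import Data.Nat.Coprimality using (Coprime)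
open import Data.Nat.DivMod using (_div_; _mod_; _%_; [m+kn]%n≡m%n; m<n⇒m%n≡m; m%n<n; m≡m%n+[m/n]*n; m≥n⇒m/n>0)
open import Data.Nat.Properties
open import Data.Nat.Tactic.RingSolver using (solve-∀)
open import Data.Product using (_×_; _,_; proj₁; proj₂; ∃; ∃-syntax; swap)
open import Data.Product.Properties using (≡-dec)
open import Data.Rational using (ℚ; mkℚ; 0ℚ; _/_; _-_; _<_; -_; ∣_∣; toℚᵘ; *<*)
  renaming (_+_ to _+ℚ_; _≤_ to _≤ℚ_)
import Data.Rational.Properties as ℚₚ
open import Data.Rational.Unnormalised as ℚᵘ using (mkℚᵘ) renaming (_≃_ to _≃ᵘ_)
import Data.Rational.Unnormalised.Properties as ℚᵘₚ
open import Data.Sum using (_⊎_; inj₁; inj₂)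
import Data.Sum as Sum
open import Data.Vec using (Vec; []; _∷_; lookup; tabulate)
open import Data.Vec.Properties using (lookup∘tabulate)
open import Defs
open import Function using (_∘_)
open import Relation.Binary.Definitions using (DecidableEquality)
open import Relation.Binary.PropositionalEquality
open import Relation.Nullary using (Dec; does; yes; no; ¬_)
open import Relation.Nullary.Decidable using (map′; _×-dec_; dec-true; dec-false)
open import Relation.Unary using (Decidable)

open import Algebra.Properties.CommutativeSemigroup +-commutativeSemigroup using (x∙yz≈y∙xz)
open import Algebra.Properties.Semiring.Sum +-*-semiring
  using (sum; sum-cong-≗; sum-replicate-zero; ∑-distrib-+; ∑-comm; *-distribˡ-sum)

-- Counting the true points of a predicate on Fin k

sum-mono-≤ : ∀ {k} {f g : Fin k → ℕ} → (∀ x → f x ≤ g x) → sum f ≤ sum g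
sum-mono-≤ {zero}  f≤g = z≤n
sum-mono-≤ {suc k} f≤g = +-mono-≤ (f≤g zero) (sum-mono-≤ (f≤g ∘ suc))

sum-≥ : ∀ {k} c {f : Fin k → ℕ} → (∀ x → c ≤ f x) → k * c ≤ sum f
sum-≥ {zero}  c c≤f = z≤n
sum-≥ {suc k} c c≤f = +-mono-≤ (c≤f zero) (sum-≥ c (c≤f ∘ suc))

bit : Bool → ℕ
bit false = 0
bit true  = 1

count : ∀ {k} → (Fin k → Bool) → ℕ
count f = sum (bit ∘ f)

without : ∀ {k} → (Fin k → Bool) → Fin k → Fin k → Bool
without f zero    zero    = false
without f zero    (suc x) = f (suc x)
without f (suc a) zero    = f zero
without f (suc a) (suc x) = without (f ∘ suc) a x

without-≢ : ∀ {k} (f : Fin k → Bool) {a x} → x ≢ a → without f a x ≡ f x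
without-≢ f {zero}  {zero}  x≢a = ⊥-elim (x≢a refl)
without-≢ f {zero}  {suc x} x≢a = refl
without-≢ f {suc a} {zero}  x≢a = refl
without-≢ f {suc a} {suc x} x≢a = without-≢ (f ∘ suc) (x≢a ∘ cong suc)

without-true : ∀ {k} (f : Fin k → Bool) a x → without f a x ≡ true → x ≢ a × f x ≡ true
without-true f zero    (suc x) fx = (λ ()) , fx
without-true f (suc a) zero    fx = (λ ()) , fx
without-true f (suc a) (suc x) fx with without-true (f ∘ suc) a x fx
... | x≢a , fx′ = x≢a ∘ Finₚ.suc-injective , fx′

without-self : ∀ {k} (f : Fin k → Bool) a → without f a a ≡ false
without-self f zero    = refl
without-self f (suc a) = without-self (f ∘ suc) a

count-cong : ∀ {k} {f g : Fin k → Bool} → f ≗ g → count f ≡ count g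
count-cong f≗g = sum-cong-≗ (cong bit ∘ f≗g)

without-cong : ∀ {k} {f g : Fin k → Bool} → f ≗ g → ∀ a → without f a ≗ without g a
without-cong f≗g zero    zero    = refl
without-cong f≗g zero    (suc x) = f≗g (suc x)
without-cong f≗g (suc a) zero    = f≗g zero
without-cong f≗g (suc a) (suc x) = without-cong (f≗g ∘ suc) a x

count-without : ∀ {k} (f : Fin k → Bool) a → count f ≡ bit (f a) + count (without f a)
count-without f zero    = refl
count-without f (suc a) = trans (cong (_+_ (bit (f zero))) (count-without (f ∘ suc) a))
                                (x∙yz≈y∙xz (bit (f zero)) (bit (f (suc a))) _)

count-without-true : ∀ {k} (f : Fin k → Bool) {a} → f a ≡ true → count f ≡ suc (count (without f a))
count-without-true f {a} fa = trans (count-without f a) (cong (λ b → bit b + count (without f a)) fa)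

count-false : ∀ {k} (f : Fin k → Bool) → (∀ x → f x ≡ false) → count f ≡ 0
count-false {zero}  f f≡false = refl
count-false {suc k} f f≡false rewrite f≡false zero = count-false (f ∘ suc) (f≡false ∘ suc)

count-only : ∀ {k} (f : Fin k → Bool) a → (∀ x → x ≢ a → f x ≡ false) → count f ≡ bit (f a)
count-only f a f≡false = trans (count-without f a)
  (trans (cong (_+_ (bit (f a))) (count-false (without f a) without≡false)) (+-identityʳ _))
  where
  without≡false : ∀ x → without f a x ≡ false
  without≡false x with x Finₚ.≟ a
  ... | yes refl = without-self f a
  ... | no x≢a = trans (without-≢ f x≢a) (f≡false x x≢a)

true⇒1≤count : ∀ {k} (f : Fin k → Bool) {a} → f a ≡ true → 1 ≤ count f
true⇒1≤count f fa rewrite count-without-true f fa = s≤s z≤n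

true²⇒2≤count : ∀ {k} (f : Fin k → Bool) {a b} → b ≢ a → f a ≡ true → f b ≡ true → 2 ≤ count f
true²⇒2≤count f {a} b≢a fa fb rewrite count-without-true f fa =
  s≤s (true⇒1≤count (without f a) (trans (without-≢ f b≢a) fb))

1≤count⇒true : ∀ {k} (f : Fin k → Bool) → 1 ≤ count f → ∃[ a ] f a ≡ true
1≤count⇒true {suc k} f 1≤c with f zero in fa
... | true  = zero , fa
... | false with 1≤count⇒true (f ∘ suc) 1≤c
...   | a , fa′ = suc a , fa′

2≤count⇒true² : ∀ {k} (f : Fin k → Bool) → 2 ≤ count f →
                ∃[ a ] ∃[ b ] (b ≢ a × f a ≡ true × f b ≡ true)
2≤count⇒true² f 2≤c with 1≤count⇒true f (≤-trans (s≤s z≤n) 2≤c)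
... | a , fa with 1≤count⇒true (without f a) (s≤s⁻¹ (subst (2 ≤_) (count-without-true f fa) 2≤c))
...   | b , wb with without-true f a b wb
...     | b≢a , fb = a , b , b≢a , fa , fb

trues : ∀ {k} → (Fin k → Bool) → List (Fin k)
trues {zero}  f = []
trues {suc k} f with f zero
... | true  = zero ∷ map suc (trues (f ∘ suc))
... | false = map suc (trues (f ∘ suc))

length-trues : ∀ {k} (f : Fin k → Bool) → length (trues f) ≡ count f
length-trues {zero}  f = refl
length-trues {suc k} f with f zero
... | true  = cong suc (trans (length-map suc (trues (f ∘ suc))) (length-trues (f ∘ suc)))
... | false = trans (length-map suc (trues (f ∘ suc))) (length-trues (f ∘ suc))

∈-trues : ∀ {k} (f : Fin k → Bool) {x} → f x ≡ true → x ∈ trues f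
∈-trues {suc k} f {zero}  fx with f zero
... | true = here refl
∈-trues {suc k} f {suc x} fx with f zero
... | true  = there (∈-map⁺ suc (∈-trues (f ∘ suc) fx))
... | false = ∈-map⁺ suc (∈-trues (f ∘ suc) fx)

trues-unique : ∀ {k} (f : Fin k → Bool) → Unique (trues f)
trues-unique {zero}  f = []
trues-unique {suc k} f with f zero
... | true  = All.¬Any⇒All¬ _ zero∉ ∷ Uniqueₚ.map⁺ Finₚ.suc-injective (trues-unique (f ∘ suc))
  where
  zero∉ : zero ∉ map suc (trues (f ∘ suc))
  zero∉ p with ∈-map⁻ suc p
  ... | _ , _ , ()
... | false = Uniqueₚ.map⁺ Finₚ.suc-injective (trues-unique (f ∘ suc))

-- Vertex sets as Boolean grids

TwiceDominated : ∀ {n m} → List (Vertex n m) → Vertex n m → Set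
TwiceDominated S v = ∃[ a ] ∃[ b ] (a ∈ S × b ∈ S × a ≢ b × Adj a v × Adj b v)

Grid : ℕ → ℕ → Set
Grid n m = Fin n → Fin m → Bool

module _ {n m : ℕ} (F : Grid n m) where

  row : Fin n → ℕ
  row i = count (F i)

  col : Fin m → ℕ
  col j = count (λ i → F i j)

  size : ℕ
  size = sum row

  neighbours : Fin n → Fin m → ℕ
  neighbours i j = count (without (F i) j) + count (without (λ i′ → F i′ j) i)

GridTotal2Dominating : ∀ {n m} → Grid n m → Set
GridTotal2Dominating F = ∀ i j → 2 ≤ neighbours F i j

row+col≡2*cell+neighbours : ∀ {n m} (F : Grid n m) i j →
  row F i + col F j ≡ 2 * bit (F i j) + neighbours F i j
row+col≡2*cell+neighbours F i j =
  trans (cong₂ _+_ (count-without (F i) j) (count-without (λ i′ → F i′ j) i))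
        (regroup (bit (F i j)) _ _)
  where
  regroup : ∀ b r c → (b + r) + (b + c) ≡ 2 * b + (r + c)
  regroup = solve-∀

dominating⇒line-bound : ∀ {n m} {F : Grid n m} → GridTotal2Dominating F →
  ∀ i j → 2 + 2 * bit (F i j) ≤ row F i + col F j
dominating⇒line-bound {F = F} dom i j = begin
  2 + 2 * bit (F i j)              ≡⟨ +-comm 2 _ ⟩
  2 * bit (F i j) + 2              ≤⟨ +-monoʳ-≤ (2 * bit (F i j)) (dom i j) ⟩
  2 * bit (F i j) + neighbours F i j ≡⟨ row+col≡2*cell+neighbours F i j ⟨
  row F i + col F j                ∎
  where open ≤-Reasoning

module _ {n m : ℕ} where

  _≟ᵥ_ : DecidableEquality (Vertex n m)
  _≟ᵥ_ = ≡-dec Finₚ._≟_ Finₚ._≟_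

  open import Data.List.Membership.DecPropositional _≟ᵥ_ using (_∈?_)

  gridOf : List (Vertex n m) → Grid n m
  gridOf S i j = does ((i , j) ∈? S)

  gridOf-∈ : ∀ {S i j} → (i , j) ∈ S → gridOf S i j ≡ true
  gridOf-∈ {S} {i} {j} = dec-true ((i , j) ∈? S)

  size-point : (v : Vertex n m) → size (λ i j → does ((i , j) ≟ᵥ v)) ≡ 1
  size-point v@(a , b) = begin
    sum (λ i → count (λ j → does ((i , j) ≟ᵥ v)))
      ≡⟨ sum-cong-≗ (λ i → count-only _ b (λ j j≢b → dec-false ((i , j) ≟ᵥ v) (j≢b ∘ cong proj₂))) ⟩
    count (λ i → does ((i , b) ≟ᵥ v))
      ≡⟨ count-only _ a (λ i i≢a → dec-false ((i , b) ≟ᵥ v) (i≢a ∘ cong proj₁)) ⟩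
    bit (does (v ≟ᵥ v))
      ≡⟨ cong bit (dec-true (v ≟ᵥ v) refl) ⟩
    1 ∎
    where open ≡-Reasoning

  size-gridOf : (S : List (Vertex n m)) → size (gridOf S) ≤ length S
  size-gridOf [] = ≤-reflexive (trans (sum-cong-≗ empty-row) (sum-replicate-zero n))
    where
    empty-row : ∀ i → row (gridOf []) i ≡ 0
    empty-row i = count-false (gridOf [] i) (λ j → refl)
  size-gridOf (v ∷ S) = begin
    size (gridOf (v ∷ S))
      ≤⟨ sum-mono-≤ (λ i → sum-mono-≤ (λ j → bit-∨ (does ((i , j) ≟ᵥ v)) (gridOf S i j))) ⟩
    sum (λ i → sum (λ j → bit (does ((i , j) ≟ᵥ v)) + bit (gridOf S i j)))
      ≡⟨ sum-cong-≗ (λ i → ∑-distrib-+ (λ j → bit (does ((i , j) ≟ᵥ v))) (bit ∘ gridOf S i)) ⟩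
    sum (λ i → count (λ j → does ((i , j) ≟ᵥ v)) + row (gridOf S) i)
      ≡⟨ ∑-distrib-+ (λ i → count (λ j → does ((i , j) ≟ᵥ v))) (row (gridOf S)) ⟩
    size (λ i j → does ((i , j) ≟ᵥ v)) + size (gridOf S)
      ≤⟨ +-mono-≤ (≤-reflexive (size-point v)) (size-gridOf S) ⟩
    suc (length S) ∎
    where
    open ≤-Reasoning
    bit-∨ : ∀ a b → bit (a ∨ b) ≤ bit a + bit b
    bit-∨ false b = ≤-refl
    bit-∨ true  b = s≤s z≤n

  gridOf-dominating : ∀ {S} → Total2Dominating S → GridTotal2Dominating (gridOf S)
  gridOf-dominating {S} dom i j with dom (i , j)
  ... | (a₁ , a₂) , (b₁ , b₂) , a∈S , b∈S , a≢b , adj-a , adj-b = two-neighbours adj-a adj-b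
    where
    rowOthers = without (gridOf S i) j
    colOthers = without (λ i′ → gridOf S i′ j) i

    in-row : ∀ {j′} → (i , j′) ∈ S → j′ ≢ j → rowOthers j′ ≡ true
    in-row p j′≢j = trans (without-≢ (gridOf S i) j′≢j) (gridOf-∈ p)

    in-col : ∀ {i′} → (i′ , j) ∈ S → i′ ≢ i → colOthers i′ ≡ true
    in-col p i′≢i = trans (without-≢ (λ i′ → gridOf S i′ j) i′≢i) (gridOf-∈ p)

    two-neighbours : Adj (a₁ , a₂) (i , j) → Adj (b₁ , b₂) (i , j) →
                     2 ≤ count rowOthers + count colOthers
    two-neighbours (inj₁ (refl , a₂≢j)) (inj₁ (refl , b₂≢j)) =
      ≤-trans (true²⇒2≤count rowOthers (a≢b ∘ cong (i ,_) ∘ sym) (in-row a∈S a₂≢j) (in-row b∈S b₂≢j))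
              (m≤m+n (count rowOthers) (count colOthers))
    two-neighbours (inj₁ (refl , a₂≢j)) (inj₂ (refl , b₁≢i)) =
      +-mono-≤ (true⇒1≤count rowOthers (in-row a∈S a₂≢j)) (true⇒1≤count colOthers (in-col b∈S b₁≢i))
    two-neighbours (inj₂ (refl , a₁≢i)) (inj₁ (refl , b₂≢j)) =
      +-mono-≤ (true⇒1≤count rowOthers (in-row b∈S b₂≢j)) (true⇒1≤count colOthers (in-col a∈S a₁≢i))
    two-neighbours (inj₂ (refl , a₁≢i)) (inj₂ (refl , b₁≢i)) =
      ≤-trans (true²⇒2≤count colOthers (a≢b ∘ cong (_, j) ∘ sym) (in-col a∈S a₁≢i) (in-col b∈S b₁≢i))
              (m≤n+m (count colOthers) (count rowOthers))

nextRow : ∀ {n m} → Vertex n m → Vertex (suc n) m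
nextRow (i , j) = suc i , j

nextRow-injective : ∀ {n m} {u v : Vertex n m} → nextRow u ≡ nextRow v → u ≡ v
nextRow-injective {u = _ , _} {v = _ , _} refl = refl

cells : ∀ {n m} → Grid n m → List (Vertex n m)
cells {zero}  F = []
cells {suc n} F = map (zero ,_) (trues (F zero)) ++ map nextRow (cells (F ∘ suc))

length-cells : ∀ {n m} (F : Grid n m) → length (cells F) ≡ size F
length-cells {zero}  F = refl
length-cells {suc n} F = begin
  length (map (zero ,_) (trues (F zero)) ++ map nextRow (cells (F ∘ suc)))
    ≡⟨ length-++ (map (zero ,_) (trues (F zero))) ⟩
  length (map (zero ,_) (trues (F zero))) + length (map nextRow (cells (F ∘ suc)))
    ≡⟨ cong₂ _+_ (length-map (zero ,_) (trues (F zero))) (length-map nextRow (cells (F ∘ suc))) ⟩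
  length (trues (F zero)) + length (cells (F ∘ suc))
    ≡⟨ cong₂ _+_ (length-trues (F zero)) (length-cells (F ∘ suc)) ⟩
  size F ∎
  where open ≡-Reasoning

∈-cells : ∀ {n m} (F : Grid n m) {i j} → F i j ≡ true → (i , j) ∈ cells F
∈-cells {suc n} F {zero}  Fij = ∈-++⁺ˡ (∈-map⁺ (zero ,_) (∈-trues (F zero) Fij))
∈-cells {suc n} F {suc i} Fij =
  ∈-++⁺ʳ (map (zero ,_) (trues (F zero))) (∈-map⁺ nextRow (∈-cells (F ∘ suc) Fij))

cells-unique : ∀ {n m} (F : Grid n m) → Unique (cells F)
cells-unique {zero}  F = []
cells-unique {suc n} F =
  Uniqueₚ.++⁺ (Uniqueₚ.map⁺ (cong proj₂) (trues-unique (F zero)))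
              (Uniqueₚ.map⁺ nextRow-injective (cells-unique (F ∘ suc)))
              disjoint
  where
  disjoint : Disjoint (map (zero ,_) (trues (F zero))) (map nextRow (cells (F ∘ suc)))
  disjoint (p , q) with ∈-map⁻ (zero ,_) p | ∈-map⁻ nextRow q
  ... | _ , _ , refl | _ , _ , ()

split-2≤+ : ∀ a b → 2 ≤ a + b → 2 ≤ a ⊎ (1 ≤ a × 1 ≤ b) ⊎ 2 ≤ b
split-2≤+ 0             b 2≤b = inj₂ (inj₂ 2≤b)
split-2≤+ 1             b 2≤b = inj₂ (inj₁ (s≤s z≤n , s≤s⁻¹ 2≤b))
split-2≤+ (suc (suc a)) b _   = inj₁ (s≤s (s≤s z≤n))

cells-dominating : ∀ {n m} {F : Grid n m} → GridTotal2Dominating F → Total2Dominating (cells F)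
cells-dominating {F = F} dom (i , j) = from-split (split-2≤+ _ _ (dom i j))
  where
  rowOthers = without (F i) j
  colOthers = without (λ i′ → F i′ j) i

  row-neighbour : ∀ {j′} → rowOthers j′ ≡ true → (i , j′) ∈ cells F × Adj (i , j′) (i , j)
  row-neighbour {j′} w with without-true (F i) j j′ w
  ... | j′≢j , Fij′ = ∈-cells F Fij′ , inj₁ (refl , j′≢j)

  col-neighbour : ∀ {i′} → colOthers i′ ≡ true → (i′ , j) ∈ cells F × Adj (i′ , j) (i , j)
  col-neighbour {i′} w with without-true (λ i′ → F i′ j) i i′ w
  ... | i′≢i , Fi′j = ∈-cells F Fi′j , inj₂ (refl , i′≢i)

  from-split : 2 ≤ count rowOthers ⊎ (1 ≤ count rowOthers × 1 ≤ count colOthers) ⊎ 2 ≤ count colOthers →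
               TwiceDominated (cells F) (i , j)
  from-split (inj₁ 2≤r) with 2≤count⇒true² rowOthers 2≤r
  ... | x , y , y≢x , wx , wy with row-neighbour wx | row-neighbour wy
  ...   | x∈ , adj-x | y∈ , adj-y = (i , x) , (i , y) , x∈ , y∈ , y≢x ∘ sym ∘ cong proj₂ , adj-x , adj-y
  from-split (inj₂ (inj₁ (1≤r , 1≤c))) with 1≤count⇒true rowOthers 1≤r | 1≤count⇒true colOthers 1≤c
  ... | x , wx | y , wy with row-neighbour wx | col-neighbour wy
  ...   | x∈ , adj-x | y∈ , adj-y =
    (i , x) , (y , j) , x∈ , y∈ , proj₁ (without-true _ i y wy) ∘ sym ∘ cong proj₁ , adj-x , adj-y
  from-split (inj₂ (inj₂ 2≤c)) with 2≤count⇒true² colOthers 2≤c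
  ... | x , y , y≢x , wx , wy with col-neighbour wx | col-neighbour wy
  ...   | x∈ , adj-x | y∈ , adj-y = (x , j) , (y , j) , x∈ , y∈ , y≢x ∘ sym ∘ cong proj₁ , adj-x , adj-y

-- The lower bound

weight : ℕ → ℕ
weight 0                   = 3
weight 1                   = 3
weight 2                   = 2
weight (suc (suc (suc _))) = 1

weight≤3 : ∀ d → weight d ≤ 3
weight≤3 0                   = ≤-refl
weight≤3 1                   = ≤-refl
weight≤3 2                   = s≤s (s≤s z≤n)
weight≤3 (suc (suc (suc d))) = s≤s z≤n

3≤weight*d : ∀ d → 1 ≤ d → 3 ≤ weight d * d
3≤weight*d 1                   _ = ≤-refl
3≤weight*d 2                   _ = s≤s (s≤s (s≤s z≤n))
3≤weight*d (suc (suc (suc d))) _ = s≤s (s≤s (s≤s z≤n))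

weight+weight≤4 : ∀ a b → 4 ≤ a + b → weight a + weight b ≤ 4
weight+weight≤4 (suc (suc (suc a))) b _ = s≤s (weight≤3 b)
weight+weight≤4 a (suc (suc (suc b))) _ = ≤-trans (≤-reflexive (+-comm (weight a) 1)) (s≤s (weight≤3 a))
weight+weight≤4 2 2 _ = ≤-refl
weight+weight≤4 0 0 ()
weight+weight≤4 0 1 (s≤s ())
weight+weight≤4 0 2 (s≤s (s≤s ()))
weight+weight≤4 1 0 (s≤s ())
weight+weight≤4 1 1 (s≤s (s≤s ()))
weight+weight≤4 1 2 (s≤s (s≤s (s≤s ())))
weight+weight≤4 2 0 (s≤s (s≤s ()))
weight+weight≤4 2 1 (s≤s (s≤s (s≤s ())))

module _ {n m} {F : Grid n m} (dom : GridTotal2Dominating F) where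

  empty-row⇒2m≤size : ∀ {i} → row F i ≡ 0 → m * 2 ≤ size F
  empty-row⇒2m≤size {i} row≡0 =
    subst (m * 2 ≤_) (sym (∑-comm (λ i j → bit (F i j)))) (sum-≥ 2 2≤col)
    where
    2≤col : ∀ j → 2 ≤ col F j
    2≤col j = ≤-trans (m≤m+n 2 (2 * bit (F i j)))
      (subst (λ r → 2 + 2 * bit (F i j) ≤ r + col F j) row≡0 (dominating⇒line-bound dom i j))

  empty-col⇒2n≤size : ∀ {j} → col F j ≡ 0 → n * 2 ≤ size F
  empty-col⇒2n≤size {j} col≡0 = sum-≥ 2 2≤row
    where
    2≤row : ∀ i → 2 ≤ row F i
    2≤row i = ≤-trans (m≤m+n 2 (2 * bit (F i j)))
      (subst (2 + 2 * bit (F i j) ≤_) (trans (cong (_+_ (row F i)) col≡0) (+-identityʳ (row F i)))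
             (dominating⇒line-bound dom i j))

  cell-weight : ∀ i j → weight (row F i) * bit (F i j) + weight (col F j) * bit (F i j) ≤ 4 * bit (F i j)
  cell-weight i j with F i j | dominating⇒line-bound dom i j
  ... | false | _     = ≤-reflexive (cong₂ _+_ (*-zeroʳ (weight (row F i))) (*-zeroʳ (weight (col F j))))
  ... | true  | 4≤r+c =
    subst (_≤ 4) (sym (cong₂ _+_ (*-identityʳ (weight (row F i))) (*-identityʳ (weight (col F j)))))
          (weight+weight≤4 (row F i) (col F j) 4≤r+c)

  weighted-count : (∀ i → 1 ≤ row F i) → (∀ j → 1 ≤ col F j) → n * 3 + m * 3 ≤ 4 * size F
  weighted-count 1≤row 1≤col = begin
    n * 3 + m * 3
      ≤⟨ +-mono-≤ (sum-≥ 3 (λ i → 3≤weight*d _ (1≤row i))) (sum-≥ 3 (λ j → 3≤weight*d _ (1≤col j))) ⟩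
    sum (λ i → weight (row F i) * row F i) + sum (λ j → weight (col F j) * col F j)
      ≡⟨ cong₂ _+_ (sum-cong-≗ (λ i → *-distribˡ-sum (weight (row F i)) (bit ∘ F i)))
                   (trans (sum-cong-≗ (λ j → *-distribˡ-sum (weight (col F j)) (λ i → bit (F i j))))
                          (∑-comm (λ j i → weight (col F j) * bit (F i j)))) ⟩
    sum (λ i → sum (λ j → weight (row F i) * bit (F i j))) +
    sum (λ i → sum (λ j → weight (col F j) * bit (F i j)))
      ≡⟨ trans (sum-cong-≗ (λ i → ∑-distrib-+ (λ j → weight (row F i) * bit (F i j))
                                               (λ j → weight (col F j) * bit (F i j))))
               (∑-distrib-+ (λ i → sum (λ j → weight (row F i) * bit (F i j)))
                            (λ i → sum (λ j → weight (col F j) * bit (F i j)))) ⟨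
    sum (λ i → sum (λ j → weight (row F i) * bit (F i j) + weight (col F j) * bit (F i j)))
      ≤⟨ sum-mono-≤ (λ i → sum-mono-≤ (cell-weight i)) ⟩
    sum (λ i → sum (λ j → 4 * bit (F i j)))
      ≡⟨ trans (*-distribˡ-sum 4 (row F)) (sum-cong-≗ (λ i → *-distribˡ-sum 4 (bit ∘ F i))) ⟨
    4 * size F ∎
    where open ≤-Reasoning

n*2≤s⇒3*n≤2*s : ∀ {n s} → n * 2 ≤ s → 3 * n ≤ 2 * s
n*2≤s⇒3*n≤2*s {n} {s} n*2≤s = begin
  3 * n        ≤⟨ *-monoˡ-≤ n (n≤1+n 3) ⟩
  4 * n        ≡⟨ *-assoc 2 2 n ⟩
  2 * (2 * n)  ≡⟨ cong (2 *_) (*-comm 2 n) ⟩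
  2 * (n * 2)  ≤⟨ *-monoʳ-≤ 2 n*2≤s ⟩
  2 * s        ∎
  where open ≤-Reasoning

grid-lower-bound : ∀ {n m} {F : Grid n m} → n ≤ m → GridTotal2Dominating F → 3 * n ≤ 2 * size F
grid-lower-bound {n} {m} {F} n≤m dom with Finₚ.any? (λ i → row F i ≟ 0)
... | yes (_ , row≡0) = n*2≤s⇒3*n≤2*s {n} (≤-trans (*-monoˡ-≤ 2 n≤m) (empty-row⇒2m≤size dom row≡0))
... | no no-empty-row with Finₚ.any? (λ j → col F j ≟ 0)
...   | yes (_ , col≡0) = n*2≤s⇒3*n≤2*s {n} (empty-col⇒2n≤size dom col≡0)
...   | no no-empty-col = *-cancelˡ-≤ 2 (begin
  2 * (3 * n)      ≡⟨ double-triple n ⟩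
  n * 3 + n * 3    ≤⟨ +-monoʳ-≤ (n * 3) (*-monoˡ-≤ 3 n≤m) ⟩
  n * 3 + m * 3    ≤⟨ weighted-count dom 1≤row 1≤col ⟩
  4 * size F       ≡⟨ *-assoc 2 2 (size F) ⟩
  2 * (2 * size F) ∎)
  where
  open ≤-Reasoning
  double-triple : ∀ n → 2 * (3 * n) ≡ n * 3 + n * 3
  double-triple = solve-∀
  1≤row : ∀ i → 1 ≤ row F i
  1≤row i = n≢0⇒n>0 (λ row≡0 → no-empty-row (i , row≡0))
  1≤col : ∀ j → 1 ≤ col F j
  1≤col j = n≢0⇒n>0 (λ col≡0 → no-empty-col (j , col≡0))

-- Existence of γ

module _ {n m} {F G : Grid n m} (F≗G : ∀ i j → F i j ≡ G i j) where

  size-cong : size F ≡ size G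
  size-cong = sum-cong-≗ (λ i → count-cong (F≗G i))

  dominating-cong : GridTotal2Dominating F → GridTotal2Dominating G
  dominating-cong dom i j = subst (2 ≤_) neighbours-cong (dom i j)
    where
    neighbours-cong : neighbours F i j ≡ neighbours G i j
    neighbours-cong = cong₂ _+_ (count-cong (without-cong (F≗G i) j))
                                (count-cong (without-cong (λ i′ → F≗G i′ j) i))

dominating? : ∀ {n m} (F : Grid n m) → Dec (GridTotal2Dominating F)
dominating? F = Finₚ.all? (λ i → Finₚ.all? (λ j → 2 ≤? neighbours F i j))

Searchable : Set → Set₁
Searchable A = ∀ {P : A → Set} → Decidable P → Dec (∃ P)

searchable-Vec : ∀ {A} → Searchable A → ∀ {k} → Searchable (Vec A k)
searchable-Vec search {zero}  P? = map′ ([] ,_) (λ { ([] , p) → p }) (P? [])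
searchable-Vec search {suc k} P? =
  map′ (λ { (a , v , p) → a ∷ v , p }) (λ { (a ∷ v , p) → a , v , p })
       (search (λ a → searchable-Vec search (λ v → P? (a ∷ v))))

least-witness : ∀ {P : ℕ → Set} → Decidable P → ∀ {b} → P b → ∃[ g ] (P g × ∀ {h} → P h → g ≤ h)
least-witness {P} P? {b} pb = from 0 b (λ ()) (subst P (sym (+-identityʳ b)) pb)
  where
  from : ∀ g d → (∀ {h} → h ℕ.< g → ¬ P h) → P (d + g) → ∃[ g ] (P g × ∀ {h} → P h → g ≤ h)
  from g d none-below p with P? g
  ... | yes pg = g , pg , λ ph → ≮⇒≥ (λ h<g → none-below h<g ph)
  from g zero    none-below p | no ¬pg = ⊥-elim (¬pg p)
  from g (suc d) none-below p | no ¬pg =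
    from (suc g) d none-up-to-g (subst P (sym (+-suc d g)) p)
    where
    none-up-to-g : ∀ {h} → h ℕ.< suc g → ¬ P h
    none-up-to-g h<1+g with m<1+n⇒m<n∨m≡n h<1+g
    ... | inj₁ h<g  = none-below h<g
    ... | inj₂ refl = ¬pg

module _ {n m : ℕ} where

  -- Grids represented as vectors, which unlike functions can be searched exhaustively.
  cellOf : Vec (Vec Bool m) n → Grid n m
  cellOf V i j = lookup (lookup V i) j

  DominatingOfSize : ℕ → Set
  DominatingOfSize g = ∃[ V ] (GridTotal2Dominating (cellOf V) × size (cellOf V) ≡ g)

  dominatingOfSize? : Decidable DominatingOfSize
  dominatingOfSize? g =
    searchable-Vec anySubset? (λ V → dominating? (cellOf V) ×-dec (size (cellOf V) ≟ g))

  dominatingOfSize : ∀ {F : Grid n m} → GridTotal2Dominating F → DominatingOfSize (size F)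
  dominatingOfSize {F} dom = V , dominating-cong (λ i j → sym (cellOf-V i j)) dom , size-cong cellOf-V
    where
    V = tabulate (λ i → tabulate (F i))
    cellOf-V : ∀ i j → cellOf V i j ≡ F i j
    cellOf-V i j rewrite lookup∘tabulate (λ i → tabulate (F i)) i = lookup∘tabulate (F i) j

  deduplicate-dominating : ∀ {S : List (Vertex n m)} → Total2Dominating S →
    ∃[ S′ ] (Unique S′ × Total2Dominating S′ × length S′ ≤ length S)
  deduplicate-dominating {S} dom =
    cells (gridOf S) , cells-unique (gridOf S) , cells-dominating (gridOf-dominating dom) ,
    ≤-trans (≤-reflexive (length-cells (gridOf S))) (size-gridOf S)

  γ-exists : ∀ {S : List (Vertex n m)} → Total2Dominating S → ∃[ g ] IsGamma2t n m g
  γ-exists {S} dom with least-witness dominatingOfSize? (dominatingOfSize (gridOf-dominating dom))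
  ... | g , (V , domV , size≡g) , minimal =
    g , (cells (cellOf V) , cells-unique (cellOf V) , cells-dominating domV ,
         trans (length-cells (cellOf V)) size≡g) ,
    λ S′ _ domS′ → ≤-trans (minimal (dominatingOfSize (gridOf-dominating domS′))) (size-gridOf S′)

  γ≤length : ∀ {g} {S : List (Vertex n m)} → IsGamma2t n m g → Total2Dominating S → g ≤ length S
  γ≤length (_ , minimal) dom with deduplicate-dominating dom
  ... | S′ , unique , dom′ , S′≤S = ≤-trans (minimal S′ unique dom′) S′≤S

  γ-lower-bound : ∀ {g} → n ≤ m → IsGamma2t n m g → 3 * n ≤ 2 * g
  γ-lower-bound n≤m ((S , _ , dom , refl) , _) =
    ≤-trans (grid-lower-bound n≤m (gridOf-dominating dom)) (*-monoʳ-≤ 2 (size-gridOf S))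

-- The construction

TwiceDominated-⊆ : ∀ {n m} {S T : List (Vertex n m)} {v} →
  (∀ {u} → u ∈ S → u ∈ T) → TwiceDominated S v → TwiceDominated T v
TwiceDominated-⊆ S⊆T (a , b , a∈S , b∈S , rest) = a , b , S⊆T a∈S , S⊆T b∈S , rest

TwiceDominated-swap : ∀ {n m} {S : List (Vertex m n)} {v : Vertex n m} →
  TwiceDominated S (swap v) → TwiceDominated (map swap S) v
TwiceDominated-swap (a , b , a∈S , b∈S , a≢b , adj-a , adj-b) =
  swap a , swap b , ∈-map⁺ swap a∈S , ∈-map⁺ swap b∈S , a≢b ∘ cong swap , Sum.swap adj-a , Sum.swap adj-b

two-avoiding : ∀ {A : Set} → DecidableEquality A → ∀ {P : A → Set} {a b c} →
  P a → P b → P c → a ≢ b → a ≢ c → b ≢ c →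
  ∀ y → ∃[ p ] ∃[ q ] (P p × P q × p ≢ q × p ≢ y × q ≢ y)
two-avoiding _≟_ {a = a} {b} pa pb pc a≢b a≢c b≢c y with a ≟ y | b ≟ y
... | yes refl | _        = _ , _ , pb , pc , b≢c , a≢b ∘ sym , a≢c ∘ sym
... | no a≢y   | yes refl = _ , _ , pa , pc , a≢c , a≢y , b≢c ∘ sym
... | no a≢y   | no b≢y   = _ , _ , pa , pb , a≢b , a≢y , b≢y

↑ˡ≢↑ʳ : ∀ {Q s} {i : Fin Q} {d : Fin s} → i ↑ˡ s ≢ Q ↑ʳ d
↑ˡ≢↑ʳ {Q} {s} {i} {d} e
  with trans (sym (Finₚ.splitAt-↑ˡ Q i s)) (trans (cong (splitAt Q) e) (Finₚ.splitAt-↑ʳ Q s d))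
... | ()

↑-view : ∀ Q {s} (x : Fin (Q + s)) → (∃[ i ] i ↑ˡ s ≡ x) ⊎ (∃[ d ] Q ↑ʳ d ≡ x)
↑-view Q x with splitAt Q x in eq
... | inj₁ i = inj₁ (i , Finₚ.splitAt⁻¹-↑ˡ eq)
... | inj₂ d = inj₂ (d , Finₚ.splitAt⁻¹-↑ʳ eq)

module _ (Q : ℕ) .{{_ : NonZero Q}} where

  spine : ∀ {s r} → List (Vertex (Q + s) (Q + r))
  spine {s} {r} = map (λ d → (toℕ d mod Q) ↑ˡ s , Q ↑ʳ d) (allFin r)

  spine-∈ : ∀ {s r} (d : Fin r) → ((toℕ d mod Q) ↑ˡ s , Q ↑ʳ d) ∈ spine
  spine-∈ d = ∈-map⁺ _ (∈-allFin d)

  length-spine : ∀ {s r} → length (spine {s} {r}) ≡ r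
  length-spine {s} {r} = trans (length-map _ (allFin r)) (length-tabulate {n = r} (λ d → d))

  mod-cyclic : ∀ (x : Fin Q) k → (toℕ x + k * Q) mod Q ≡ x
  mod-cyclic x k = Finₚ.toℕ-injective (begin
    toℕ ((toℕ x + k * Q) mod Q) ≡⟨ Finₚ.toℕ-fromℕ< _ ⟩
    (toℕ x + k * Q) % Q         ≡⟨ [m+kn]%n≡m%n (toℕ x) k Q ⟩
    toℕ x % Q                   ≡⟨ m<n⇒m%n≡m (Finₚ.toℕ<n x) ⟩
    toℕ x                       ∎)
    where open ≡-Reasoning

  spine-row : ∀ {s r} → 3 * Q ≤ r → ∀ (x : Fin Q) y → TwiceDominated (spine {s} {r}) (x ↑ˡ s , y)
  spine-row {s} {r} 3Q≤r x y with two-avoiding Finₚ._≟_ (in-row 0F) (in-row 1F) (in-row 2F)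
                                    (distinct {0F} {1F} (λ ())) (distinct {0F} {2F} (λ ()))
                                    (distinct {1F} {2F} (λ ())) y
    where
    offset<r : ∀ (k : Fin 3) → toℕ x + toℕ k * Q ℕ.< r
    offset<r k = begin-strict
      toℕ x + toℕ k * Q  <⟨ +-monoˡ-< (toℕ k * Q) (Finₚ.toℕ<n x) ⟩
      suc (toℕ k) * Q    ≤⟨ *-monoˡ-≤ Q (Finₚ.toℕ<n k) ⟩
      3 * Q              ≤⟨ 3Q≤r ⟩
      r                  ∎
      where open ≤-Reasoning
    column : Fin 3 → Fin (Q + r)
    column k = Q ↑ʳ fromℕ< (offset<r k)
    distinct : ∀ {k l} → k ≢ l → column k ≢ column l
    distinct {k} {l} k≢l e = k≢l (Finₚ.toℕ-injective (*-cancelʳ-≡ (toℕ k) (toℕ l) Q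
      (+-cancelˡ-≡ (toℕ x) _ _ (trans (sym (Finₚ.toℕ-fromℕ< (offset<r k)))
        (trans (cong toℕ (Finₚ.↑ʳ-injective Q _ _ e)) (Finₚ.toℕ-fromℕ< (offset<r l)))))))
    in-row : ∀ k → (x ↑ˡ s , column k) ∈ spine {s} {r}
    in-row k = subst (λ i → (i ↑ˡ s , column k) ∈ spine {s} {r})
                     (trans (cong (_mod Q) (Finₚ.toℕ-fromℕ< (offset<r k))) (mod-cyclic x (toℕ k)))
                     (spine-∈ (fromℕ< (offset<r k)))
  ... | p , q , p∈ , q∈ , p≢q , p≢y , q≢y =
    (x ↑ˡ s , p) , (x ↑ˡ s , q) , p∈ , q∈ , p≢q ∘ cong proj₂ , inj₁ (refl , p≢y) , inj₁ (refl , q≢y)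

  spines : ∀ {s r} → List (Vertex (Q + s) (Q + r))
  spines {s} {r} = spine {s} {r} ++ map swap (spine {r} {s})

  length-spines : ∀ {s r} → length (spines {s} {r}) ≡ r + s
  length-spines {s} {r} = begin
    length (spine {s} {r} ++ map swap (spine {r} {s}))
      ≡⟨ length-++ (spine {s} {r}) ⟩
    length (spine {s} {r}) + length (map swap (spine {r} {s}))
      ≡⟨ cong (_+_ (length (spine {s} {r}))) (length-map swap (spine {r} {s})) ⟩
    length (spine {s} {r}) + length (spine {r} {s})
      ≡⟨ cong₂ _+_ (length-spine {s} {r}) (length-spine {r} {s}) ⟩
    r + s ∎
    where open ≡-Reasoning

  spines-dominating : ∀ {s r} → 3 * Q ≤ s → 3 * Q ≤ r → Total2Dominating (spines {s} {r})
  spines-dominating {s} {r} 3Q≤s 3Q≤r (x , y) with ↑-view Q x | ↑-view Q y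
  ... | inj₁ (i , refl) | _ = TwiceDominated-⊆ ∈-++⁺ˡ (spine-row 3Q≤r i y)
  ... | inj₂ _ | inj₁ (j , refl) =
    TwiceDominated-⊆ (∈-++⁺ʳ (spine {s} {r})) (TwiceDominated-swap (spine-row 3Q≤s j x))
  ... | inj₂ (dx , refl) | inj₂ (dy , refl) =
    ((toℕ dy mod Q) ↑ˡ s , Q ↑ʳ dy) , (Q ↑ʳ dx , (toℕ dx mod Q) ↑ˡ r) ,
    ∈-++⁺ˡ (spine-∈ dy) , ∈-++⁺ʳ (spine {s} {r}) (∈-map⁺ swap (spine-∈ dx)) ,
    ↑ˡ≢↑ʳ ∘ cong proj₁ , inj₂ (refl , ↑ˡ≢↑ʳ) , inj₁ (refl , ↑ˡ≢↑ʳ)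

quarter-split : ∀ n → 4 ≤ n → ∃[ Q ] ∃[ s ] (NonZero Q × 3 * Q ≤ s × s ≤ 3 * Q + 3 × n ≡ Q + s)
quarter-split n 4≤n =
  n div 4 , 3 * (n div 4) + n % 4 , >-nonZero (m≥n⇒m/n>0 4≤n) ,
  m≤m+n (3 * (n div 4)) (n % 4) , +-monoʳ-≤ (3 * (n div 4)) (s≤s⁻¹ (m%n<n n 4)) ,
  trans (m≡m%n+[m/n]*n n 4) (regroup (n div 4) (n % 4))
  where
  regroup : ∀ Q t → t + Q * 4 ≡ Q + (3 * Q + t)
  regroup = solve-∀

upper-bound : ∀ Q s k .{{_ : NonZero Q}} → 3 * Q ≤ s → s ≤ 3 * Q + 3 →
  ∃[ S ] (Total2Dominating {Q + s} {Q + (s + k)} S × 2 * length S ≤ 3 * (Q + s) + (2 * k + 3))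
upper-bound Q s k 3Q≤s s≤3Q+3 =
  spines Q , spines-dominating Q 3Q≤s (≤-trans 3Q≤s (m≤m+n s k)) , (begin
    2 * length (spines Q {s} {s + k})  ≡⟨ cong (2 *_) (length-spines Q {s} {s + k}) ⟩
    2 * ((s + k) + s)                  ≡⟨ lhs s k ⟩
    s + (3 * s + 2 * k)                ≤⟨ +-monoˡ-≤ (3 * s + 2 * k) s≤3Q+3 ⟩
    (3 * Q + 3) + (3 * s + 2 * k)      ≡⟨ rhs Q s k ⟩
    3 * (Q + s) + (2 * k + 3)          ∎)
  where
  open ≤-Reasoning
  lhs : ∀ s k → 2 * ((s + k) + s) ≡ s + (3 * s + 2 * k)
  lhs = solve-∀
  rhs : ∀ Q s k → (3 * Q + 3) + (3 * s + 2 * k) ≡ 3 * (Q + s) + (2 * k + 3)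
  rhs = solve-∀

γ-bounds : ∀ k n → 4 ≤ n → ∃[ g ] (IsGamma2t n (n + k) g × 3 * n ≤ 2 * g × 2 * g ≤ 3 * n + (2 * k + 3))
γ-bounds k n 4≤n with quarter-split n 4≤n
... | Q , s , nonZero , 3Q≤s , s≤3Q+3 , refl rewrite +-assoc Q s k
  with upper-bound Q s k {{nonZero}} 3Q≤s s≤3Q+3
...   | S , dom , 2S≤ with γ-exists dom
...     | g , γ =
  g , γ , γ-lower-bound (+-monoʳ-≤ Q (m≤m+n s k)) γ , ≤-trans (*-monoʳ-≤ 2 (γ≤length γ dom)) 2S≤

-- The rational estimate

∣p-q∣<r : ∀ {p q r : ℚ} → q ≤ℚ p → p < r +ℚ q → ∣ p - q ∣ < r
∣p-q∣<r {p} {q} {r} q≤p p<r+q = subst (_< r) (sym (ℚₚ.0≤p⇒∣p∣≡p 0≤p-q)) p-q<r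
  where
  0≤p-q : 0ℚ ≤ℚ p - q
  0≤p-q = subst (_≤ℚ p - q) (ℚₚ.+-inverseʳ q) (ℚₚ.+-monoˡ-≤ (- q) q≤p)
  r+q-q≡r : r +ℚ q - q ≡ r
  r+q-q≡r = trans (ℚₚ.+-assoc r q (- q)) (trans (cong (r +ℚ_) (ℚₚ.+-inverseʳ q)) (ℚₚ.+-identityʳ r))
  p-q<r : p - q < r
  p-q<r = subst (p - q <_) r+q-q≡r (ℚₚ.+-monoˡ-< (- q) p<r+q)

fraction-≤ : ∀ a b c d → a * suc d ≤ c * suc b → + a / suc b ≤ℚ + c / suc d
fraction-≤ a b c d ad≤cb = ℚₚ.toℚᵘ-cancel-≤
  (ℚᵘₚ.≤-respˡ-≃ (ℚᵘₚ.≃-sym (ℚₚ.toℚᵘ-fromℚᵘ (mkℚᵘ (+ a) b)))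
  (ℚᵘₚ.≤-respʳ-≃ (ℚᵘₚ.≃-sym (ℚₚ.toℚᵘ-fromℚᵘ (mkℚᵘ (+ c) d)))
  (ℚᵘ.*≤* (subst₂ ℤ._≤_ (ℤₚ.pos-* a (suc d)) (ℤₚ.pos-* c (suc b)) (ℤ.+≤+ ad≤cb)))))

fraction<fraction+fraction : ∀ a b c d e f →
  a * (suc d * suc f) ℕ.< (c * suc f + e * suc d) * suc b →
  + a / suc b < + c / suc d +ℚ + e / suc f
fraction<fraction+fraction a b c d e f ineq = ℚₚ.toℚᵘ-cancel-<
  (ℚᵘₚ.<-respˡ-≃ (ℚᵘₚ.≃-sym (ℚₚ.toℚᵘ-fromℚᵘ (mkℚᵘ (+ a) b)))
  (ℚᵘₚ.<-respʳ-≃ (ℚᵘₚ.≃-sym sum≃)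
  (ℚᵘ.*<* (subst₂ ℤ._<_ (ℤₚ.pos-* a (suc d * suc f)) numerator (ℤ.+<+ ineq)))))
  where
  sum≃ : toℚᵘ (+ c / suc d +ℚ + e / suc f) ≃ᵘ mkℚᵘ (+ c) d ℚᵘ.+ mkℚᵘ (+ e) f
  sum≃ = ℚᵘₚ.≃-trans (ℚₚ.toℚᵘ-homo-+ (+ c / suc d) (+ e / suc f))
                     (ℚᵘₚ.+-cong (ℚₚ.toℚᵘ-fromℚᵘ (mkℚᵘ (+ c) d)) (ℚₚ.toℚᵘ-fromℚᵘ (mkℚᵘ (+ e) f)))
  numerator : + ((c * suc f + e * suc d) * suc b) ≡ (+ c ℤ.* + suc f ℤ.+ + e ℤ.* + suc d) ℤ.* + suc b
  numerator = trans (ℤₚ.pos-* (c * suc f + e * suc d) (suc b))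
                    (cong (ℤ._* + suc b) (trans (ℤₚ.pos-+ (c * suc f) (e * suc d))
                                                (cong₂ ℤ._+_ (ℤₚ.pos-* c (suc f)) (ℤₚ.pos-* e (suc d)))))

close-to-3/2 : ∀ {n g C P d} .{c : Coprime (suc P) (suc d)} → 3 * suc n ≤ 2 * g → 2 * g ≤ 3 * suc n + C → suc d * C ℕ.< suc n →
  ∣ (+ g / suc n) - (+ 3 / 2) ∣ < mkℚ +[1+ P ] d c
close-to-3/2 {n} {g} {C} {P} {d} {c} 3n≤2g 2g≤3n+C dC<n =
  ∣p-q∣<r (fraction-≤ 3 1 g n (subst (3 * suc n ≤_) (*-comm 2 g) 3n≤2g))
          (subst (λ ε → + g / suc n < ε +ℚ + 3 / 2) (ℚₚ.↥p/↧p≡p (mkℚ +[1+ P ] d c))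
                 (fraction<fraction+fraction g n (suc P) d 3 1 bound))
  where
  open ≤-Reasoning
  swap-factors : ∀ g D → g * (D * 2) ≡ D * (2 * g)
  swap-factors = solve-∀
  collect : ∀ D N P′ → D * (3 * N) + P′ * 2 * N ≡ (P′ * 2 + 3 * D) * N
  collect = solve-∀
  bound : g * (suc d * 2) ℕ.< (suc P * 2 + 3 * suc d) * suc n
  bound = begin-strict
    g * (suc d * 2)                          ≡⟨ swap-factors g (suc d) ⟩
    suc d * (2 * g)                          ≤⟨ *-monoʳ-≤ (suc d) 2g≤3n+C ⟩
    suc d * (3 * suc n + C)                  ≡⟨ *-distribˡ-+ (suc d) (3 * suc n) C ⟩
    suc d * (3 * suc n) + suc d * C          <⟨ +-monoʳ-< (suc d * (3 * suc n)) dC<n ⟩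
    suc d * (3 * suc n) + suc n              ≤⟨ +-monoʳ-≤ (suc d * (3 * suc n)) (m≤n*m (suc n) (suc P * 2)) ⟩
    suc d * (3 * suc n) + suc P * 2 * suc n  ≡⟨ collect (suc d) (suc n) (suc P) ⟩
    (suc P * 2 + 3 * suc d) * suc n          ∎

theorem2p18 : (k : ℕ) → (ε : ℚ) → 0ℚ < ε →
    ∃[ N ] ((n : ℕ) → N ≤ n → .{{_ : NonZero n}} →
      ∃[ g ] (IsGamma2t n (n + k) g × ∣ (+ g / n) - (+ 3 / 2) ∣ < ε))
theorem2p18 k (mkℚ +0         _ _) (*<* (ℤ.+<+ ()))
theorem2p18 k (mkℚ -[1+ _ ]   _ _) (*<* ())
-- ε ≥ 1/(d+1), while |γ/n − 3/2| ≤ (2k+3)/(2n), and the construction needs n ≥ 4.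
theorem2p18 k (mkℚ +[1+ P ] d _) _ = suc d * (2 * k + 3) + 4 , close
  where
  close : (n : ℕ) → suc d * (2 * k + 3) + 4 ≤ n → .{{_ : NonZero n}} →
          ∃[ g ] (IsGamma2t n (n + k) g × ∣ (+ g / n) - (+ 3 / 2) ∣ < mkℚ +[1+ P ] d _)
  close (suc n) N≤n with γ-bounds k (suc n) (≤-trans (m≤n+m 4 _) N≤n)
  ... | g , γ , lower , upper = g , γ , close-to-3/2 {g = g} lower upper (<-≤-trans (m<m+n _ (s≤s z≤n)) N≤n)
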